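{- Let $\mathcal{G}$ be a graph class containing $K_2$, let $\mathrm x\in\{\mathrm g,\mathrm u,\mathrm l,\mathrm f\}$, and let $H$ be a graph. Then: (i) if $\mathcal{G}$ is monotone, then $c^{\mathcal{G}}_{\mathrm x}(H')\le c^{\mathcal{G}}_{\mathrm x}(H)$ for every subgraph $H'$ of $H$; (ii) if $\mathcal{G}$ is hereditary, then $c^{\mathcal{G}}_{\mathrm x}(H')\le c^{\mathcal{G}}_{\mathrm x}(H)$ for every induced subgraph $H'$ of $H$; (iii) if $\mathcal{G}$ is hereditary and $\mathrm x\ne\mathrm g$, then $c^{\mathcal{G}}_{\mathrm x}(H')\le c^{\mathcal{G}}_{\mathrm x}(H)$ for every weak induced subgraph $H'$ of $H$.
   Context: All graphs are finite and simple. A class is monotone if closed under subgraphs and hereditary if closed under induced subgraphs. A subgraph $H'$ of $H$ is weak induced if each connected component of $H'$ is an induced subgraph of $H$. For graphs $G,H$, a homomorphism $\varphi\colon G\to H$ is a map $V(G)\to V(H)$ with $\varphi(u)\varphi(v)\in E(H)$ whenever $uv\in E(G)$. $\dot\cup$ denotes vertex-disjoint union. For a graph class $\mathcal{G}$ and a graph $H$, a $\mathcal{G}$-cover of $H$ is an edge-surjective homomorphism $\varphi\colon G_1\dot\cup\cdots\dot\cup G_t\to H$ with all $G_i\in\mathcal{G}$; it is called $t$-global, injective if each $\varphi|_{G_i}$ is injective, and $s$-local if $|\varphi^{ -1}(v)|\le s$ for all $v\in V(H)$. $\overline{\mathcal{G}}$ is the class of all vertex-disjoint unions of graphs in $\mathcal{G}$.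 $c^{\mathcal{G}}_{\mathrm g}(H)$ is the least $t$ such that $H$ has a $t$-global injective $\mathcal{G}$-cover; $c^{\mathcal{G}}_{\mathrm u}(H)$ the least $t$ such that $H$ has a $t$-global injective $\overline{\mathcal{G}}$-cover; $c^{\mathcal{G}}_{\mathrm l}(H)$ the least $s$ such that $H$ has an $s$-local injective $\mathcal{G}$-cover; $c^{\mathcal{G}}_{\mathrm f}(H)$ the least $s$ such that $H$ has an $s$-local (not necessarily injective) $\mathcal{G}$-cover. -}

module Defs where

open import Data.Nat using (ℕ; zero; suc; _+_; _≤_)
open import Data.Fin using (Fin; splitAt; zero; suc)
open import Data.Fin.Properties using (_≟_)
open import Data.Bool using (Bool; true; false)
open import Data.Sum using (_⊎_; inj₁; inj₂)
open import Data.Product using (Σ; Σ-syntax; ∃; ∃-syntax; _×_; _,_)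
open import Data.List using (List; []; _∷_; length; filter; map; allFin)
open import Data.Nat.ListAction using (sum)
open import Data.List.Relation.Unary.All using (All)
open import Relation.Binary.PropositionalEquality using (_≡_; refl)
open import Relation.Nullary using (¬_)
open import Function.Definitions using (Injective)

record Graph : Set where
  field
    n      : ℕ
    adj    : Fin n → Fin n → Bool
    sym    : ∀ u v → adj u v ≡ adj v u
    irrefl : ∀ u → adj u u ≡ false

open Graph public

V : Graph → Set
V G = Fin (n G)

E : (G : Graph) → V G → V G → Set
E G u v = adj G u v ≡ true

K₂ : Graph
K₂ = record { n = 2 ; adj = a ; sym = s ; irrefl = i }
  where
  a : Fin 2 → Fin 2 → Bool
  a zero zero = false
  a zero (suc zero) = true
  a (suc zero) zero = true
  a (suc zero) (suc zero) = false
  s : ∀ u v → a u v ≡ a v u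
  s zero zero = refl
  s zero (suc zero) = refl
  s (suc zero) zero = refl
  s (suc zero) (suc zero) = refl
  i : ∀ u → a u u ≡ false
  i zero = refl
  i (suc zero) = refl

Empty : Graph
Empty = record { n = 0 ; adj = λ () ; sym = λ () ; irrefl = λ () }

_⊕_ : Graph → Graph → Graph
G ⊕ H = record { n = n G + n H ; adj = a ; sym = s ; irrefl = i }
  where
  a' : V G ⊎ V H → V G ⊎ V H → Bool
  a' (inj₁ x) (inj₁ y) = adj G x y
  a' (inj₂ x) (inj₂ y) = adj H x y
  a' (inj₁ x) (inj₂ y) = false
  a' (inj₂ x) (inj₁ y) = false
  a : Fin (n G + n H) → Fin (n G + n H) → Bool
  a u v = a' (splitAt (n G) u) (splitAt (n G) v)
  s' : ∀ p q → a' p q ≡ a' q p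
  s' (inj₁ x) (inj₁ y) = sym G x y
  s' (inj₂ x) (inj₂ y) = sym H x y
  s' (inj₁ x) (inj₂ y) = refl
  s' (inj₂ x) (inj₁ y) = refl
  s : ∀ u v → a u v ≡ a v u
  s u v = s' (splitAt (n G) u) (splitAt (n G) v)
  i' : ∀ p → a' p p ≡ false
  i' (inj₁ x) = irrefl G x
  i' (inj₂ x) = irrefl H x
  i : ∀ u → a u u ≡ false
  i u = i' (splitAt (n G) u)

⨁ : List Graph → Graph
⨁ [] = Empty
⨁ (G ∷ Gs) = G ⊕ ⨁ Gs

record Iso (G H : Graph) : Set where
  field
    to      : V G → V H
    from    : V H → V G
    from∘to : ∀ u → from (to u) ≡ u
    to∘from : ∀ v → to (from v) ≡ v
    pres    : ∀ u v → adj H (to u) (to v) ≡ adj G u v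

Subgraph : Graph → Graph → Set
Subgraph H' H =
  Σ[ f ∈ (V H' → V H) ] Injective _≡_ _≡_ f
    × (∀ u v → E H' u v → E H (f u) (f v))

InducedSubgraph : Graph → Graph → Set
InducedSubgraph H' H =
  Σ[ f ∈ (V H' → V H) ] Injective _≡_ _≡_ f
    × (∀ u v → adj H (f u) (f v) ≡ adj H' u v)

data Reach (G : Graph) : V G → V G → Set where
  here : ∀ {u} → Reach G u u
  step : ∀ {u w v} → E G u w → Reach G w v → Reach G u v

-- H' is (isomorphic to) a weak induced subgraph of H: a subgraph each of
-- whose connected components is induced in H.
WeakInducedSubgraph : Graph → Graph → Set
WeakInducedSubgraph H' H =
  Σ[ f ∈ (V H' → V H) ] Injective _≡_ _≡_ f
    × (∀ u v → E H' u v → E H (f u) (f v))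
    × (∀ u v → Reach H' u v → E H (f u) (f v) → E H' u v)

GraphClass : Set₁
GraphClass = Graph → Set

Monotone : GraphClass → Set
Monotone 𝒢 = ∀ G H → Subgraph H G → 𝒢 G → 𝒢 H

Hereditary : GraphClass → Set
Hereditary 𝒢 = ∀ G H → InducedSubgraph H G → 𝒢 G → 𝒢 H

Overline : GraphClass → GraphClass
Overline 𝒢 G = Σ[ Gs ∈ List Graph ] All 𝒢 Gs × Iso G (⨁ Gs)

-- A 𝒢-cover of H: an edge-surjective homomorphism
-- G₁ ⊍ ⋯ ⊍ G_t → H with all Gᵢ ∈ 𝒢 (given componentwise).
record Cover (𝒢 : GraphClass) (H : Graph) : Set where
  field
    t    : ℕ
    comp : Fin t → Graph
    inC  : ∀ i → 𝒢 (comp i)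
    φ    : ∀ i → V (comp i) → V H
    hom  : ∀ i a b → E (comp i) a b → E H (φ i a) (φ i b)
    surj : ∀ u v → E H u v →
           Σ[ i ∈ Fin t ] Σ[ a ∈ V (comp i) ] Σ[ b ∈ V (comp i) ]
             (E (comp i) a b × φ i a ≡ u × φ i b ≡ v)

  load : V H → ℕ
  load v = sum (map (λ i → length (filter (λ a → φ i a ≟ v) (allFin (n (comp i)))))
                    (allFin t))

open Cover public

IsInjective : ∀ {𝒢 H} → Cover 𝒢 H → Set
IsInjective C = ∀ i → Injective _≡_ _≡_ (φ C i)

IsGlobal : ∀ {𝒢 H} → ℕ → Cover 𝒢 H → Set
IsGlobal k C = t C ≡ k

IsLocal : ∀ {𝒢 H} → ℕ → Cover 𝒢 H → Set
IsLocal {H = H} s C = ∀ (v : V H) → load C v ≤ s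

data Kind : Set where
  g u l f : Kind

-- HasCover x 𝒢 H k : the defining property of c^𝒢_x(H) holds for value k.
HasCover : Kind → GraphClass → Graph → ℕ → Set
HasCover g 𝒢 H k = Σ[ C ∈ Cover 𝒢 H ] IsGlobal k C × IsInjective C
HasCover u 𝒢 H k = Σ[ C ∈ Cover (Overline 𝒢) H ] IsGlobal k C × IsInjective C
HasCover l 𝒢 H k = Σ[ C ∈ Cover 𝒢 H ] IsLocal k C × IsInjective C
HasCover f 𝒢 H k = Σ[ C ∈ Cover 𝒢 H ] IsLocal k C

IsCoverNumber : Kind → GraphClass → Graph → ℕ → Set
IsCoverNumber x 𝒢 H k = HasCover x 𝒢 H k × (∀ k' → HasCover x 𝒢 H k' → k ≤ k')

module Submission where

-- Given an embedding emb : H' → H and a cover φ : G₁ ⊍ ⋯ ⊍ G_t → H, restrict each Gᵢ to the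
-- vertices lying over emb(H') and keep only the edges lying over edges of H'. This is a subgraph
-- of Gᵢ, which is enough for a monotone class. For a hereditary class, label H' so that it is
-- induced in H on every label class (a single class for an induced subgraph, the connected
-- components for a weak induced one) and restrict Gᵢ to one class at a time; these restrictions
-- are induced subgraphs of Gᵢ. The pieces cover H', inherit injectivity, and a vertex x of H' has
-- no more preimages than emb x had. Only the number of pieces grows, by the number L of classes,
-- which c_g cannot afford unless L = 1; for c_u the pieces coming from one Gᵢ are put back
-- together into a single disjoint union.

open import Defs
open import Data.Bool using (_∧_; true; false) renaming (_≟_ to _≟ᵇ_)
open import Data.Empty using (⊥-elim)
open import Data.Fin using (Fin; zero; suc; splitAt; join; _↑ˡ_; _↑ʳ_; combine; remQuot)
open import Data.Fin.Properties
  using ( _≟_; any?; injective⇒≤; suc-injective; ↑ˡ-injective; ↑ʳ-injective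
        ; splitAt-↑ˡ; splitAt-↑ʳ; splitAt⁻¹-↑ˡ; splitAt⁻¹-↑ʳ; join-splitAt
        ; remQuot-combine; combine-remQuot)
open import Data.List using (List; []; _∷_; length; filter; tabulate; allFin; lookup; cartesianProduct)
open import Data.List.Properties using (map-tabulate; tabulate-lookup)
open import Data.List.Membership.Propositional using (_∈_)
open import Data.List.Membership.Propositional.Properties
  using (∈-lookup; ∈-filter⁺; ∈-allFin; ∈-cartesianProduct⁺)
open import Data.List.Relation.Unary.All as All using (All; []; _∷_)
open import Data.List.Relation.Unary.All.Properties using (tabulate⁺; all-filter)
open import Data.List.Relation.Unary.Any using (here; there)
open import Data.Nat using (ℕ; zero; suc; _+_; _*_; _≤_)
open import Data.Nat.ListAction using (sum)
open import Data.Nat.Properties using (≤-trans; *-identityʳ)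
open import Data.Product using (Σ; Σ-syntax; _×_; _,_; proj₁; proj₂; uncurry)
open import Data.Product.Properties.WithK using (,-injectiveʳ)
open import Data.Sum using (_⊎_; inj₁; inj₂)
open import Function using (_∘_; id)
open import Function.Definitions using (Injective)
open import Relation.Binary.PropositionalEquality
  using (_≡_; _≢_; refl; trans; cong; cong₂; subst; subst₂; module ≡-Reasoning)
  renaming (sym to ≡-sym)
open import Relation.Nullary using (¬_; yes; no)
open import Relation.Nullary.Decidable using (_×-dec_)
open import Relation.Unary using (Decidable)

record Enumeration {X : Set} (Q : X → Set) (k : ℕ) : Set where
  field
    pos           : Fin k → X
    pos-injective : Injective _≡_ _≡_ pos
    pos-sat       : ∀ j → Q (pos j)
    index         : ∀ x → Q x → Fin k
    pos-index     : ∀ x q → pos (index x q) ≡ x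

open Enumeration

enumeration-≤ : ∀ {X X' : Set} {Q : X → Set} {Q' : X' → Set} {k k'} →
  Enumeration Q k → Enumeration Q' k' → (κ : X → X') → (∀ {x} → Q x → Q' (κ x)) →
  (∀ {x y} → Q x → Q y → κ x ≡ κ y → x ≡ y) → k ≤ k'
enumeration-≤ A B κ κ-sat κ-inj = injective⇒≤ {f = via} via-injective
  where
  via : Fin _ → Fin _
  via j = index B (κ (pos A j)) (κ-sat (pos-sat A j))
  via-injective : Injective _≡_ _≡_ via
  via-injective {i} {j} eq = pos-injective A (κ-inj (pos-sat A i) (pos-sat A j) (begin
    κ (pos A i)   ≡⟨ pos-index B _ _ ⟨
    pos B (via i) ≡⟨ cong (pos B) eq ⟩
    pos B (via j) ≡⟨ pos-index B _ _ ⟩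
    κ (pos A j)   ∎))
    where open ≡-Reasoning

enumeration-empty : ∀ {X : Set} {Q : X → Set} → ¬ X → Enumeration Q 0
enumeration-empty ¬x = record
  { pos = λ () ; pos-injective = λ { {()} } ; pos-sat = λ ()
  ; index = λ x _ → ⊥-elim (¬x x) ; pos-index = λ x _ → ⊥-elim (¬x x) }

module _ {m k} {Q : Fin (suc m) → Set} (R : Enumeration (Q ∘ suc) k) where

  enumeration-cons : Q zero → Enumeration Q (suc k)
  enumeration-cons q₀ = record
    { pos           = λ { zero → zero ; (suc j) → suc (pos R j) }
    ; pos-injective = λ { {zero} {zero} _ → refl
                        ; {suc i} {suc j} eq → cong suc (pos-injective R (suc-injective eq))
                        ; {zero} {suc _} () ; {suc _} {zero} () }
    ; pos-sat       = λ { zero → q₀ ; (suc j) → pos-sat R j }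
    ; index         = λ { zero _ → zero ; (suc x) q → suc (index R x q) }
    ; pos-index     = λ { zero _ → refl ; (suc x) q → cong suc (pos-index R x q) } }

  enumeration-skip : ¬ Q zero → Enumeration Q k
  enumeration-skip ¬q₀ = record
    { pos           = suc ∘ pos R
    ; pos-injective = pos-injective R ∘ suc-injective
    ; pos-sat       = pos-sat R
    ; index         = λ { zero q → ⊥-elim (¬q₀ q) ; (suc x) q → index R x q }
    ; pos-index     = λ { zero q → ⊥-elim (¬q₀ q) ; (suc x) q → cong suc (pos-index R x q) } }

filter-enumeration : ∀ {A : Set} {P : A → Set} (P? : Decidable P) {m} (h : Fin m → A) →
  Enumeration (P ∘ h) (length (filter P? (tabulate h)))
filter-enumeration P? {zero}  h = enumeration-empty λ ()
filter-enumeration P? {suc m} h with P? (h zero)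
... | yes p = enumeration-cons (filter-enumeration P? (h ∘ suc)) p
... | no ¬p = enumeration-skip (filter-enumeration P? (h ∘ suc)) ¬p

module _ {t a b} {X : Fin (suc t) → Set} {Q : ∀ i → X i → Set}
  (A : Enumeration (Q zero) a) (B : Enumeration (uncurry (Q ∘ suc)) b) where

  private
    sucΣ : Σ (Fin t) (X ∘ suc) → Σ (Fin (suc t)) X
    sucΣ y = suc (proj₁ y) , proj₂ y

    sucΣ-injective : Injective _≡_ _≡_ sucΣ
    sucΣ-injective {_ , _} {_ , _} refl = refl

    pos⊎ : Fin a ⊎ Fin b → Σ (Fin (suc t)) X
    pos⊎ (inj₁ j) = zero , pos A j
    pos⊎ (inj₂ j) = sucΣ (pos B j)

    pos⊎-injective : Injective _≡_ _≡_ pos⊎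
    pos⊎-injective {inj₁ _} {inj₁ _} eq = cong inj₁ (pos-injective A (,-injectiveʳ eq))
    pos⊎-injective {inj₂ _} {inj₂ _} eq = cong inj₂ (pos-injective B (sucΣ-injective eq))
    pos⊎-injective {inj₁ _} {inj₂ _} ()
    pos⊎-injective {inj₂ _} {inj₁ _} ()

    pos⊎-sat : ∀ s → uncurry Q (pos⊎ s)
    pos⊎-sat (inj₁ j) = pos-sat A j
    pos⊎-sat (inj₂ j) = pos-sat B j

    index⊎ : ∀ y → uncurry Q y → Fin (a + b)
    index⊎ (zero  , x) q = index A x q ↑ˡ b
    index⊎ (suc i , x) q = a ↑ʳ index B (i , x) q

    pos⊎-index⊎ : ∀ y q → pos⊎ (splitAt a (index⊎ y q)) ≡ y
    pos⊎-index⊎ (zero , x) q rewrite splitAt-↑ˡ a (index A x q) b = cong (zero ,_) (pos-index A x q)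
    pos⊎-index⊎ (suc i , x) q rewrite splitAt-↑ʳ a b (index B (i , x) q) | pos-index B (i , x) q = refl

  Σ-enumeration-suc : Enumeration (uncurry Q) (a + b)
  Σ-enumeration-suc = record
    { pos           = pos⊎ ∘ splitAt a
    ; pos-injective = λ {i} {j} eq → begin
        i                      ≡⟨ join-splitAt a b i ⟨
        join a b (splitAt a i) ≡⟨ cong (join a b) (pos⊎-injective eq) ⟩
        join a b (splitAt a j) ≡⟨ join-splitAt a b j ⟩
        j                      ∎
    ; pos-sat       = pos⊎-sat ∘ splitAt a
    ; index         = index⊎
    ; pos-index     = pos⊎-index⊎ }
    where open ≡-Reasoning

Σ-enumeration : ∀ {t} {X : Fin t → Set} {Q : ∀ i → X i → Set} {h : Fin t → ℕ} →
  (∀ i → Enumeration (Q i) (h i)) → Enumeration (uncurry Q) (sum (tabulate h))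
Σ-enumeration {zero}  _ = enumeration-empty λ ()
Σ-enumeration {suc t} E = Σ-enumeration-suc (E zero) (Σ-enumeration (E ∘ suc))

Key : ∀ {𝒢 H} → Cover 𝒢 H → Set
Key C = Σ (Fin (t C)) (λ i → V (comp C i))

Fibre : ∀ {𝒢 H} (C : Cover 𝒢 H) → V H → Key C → Set
Fibre C v (i , a) = φ C i a ≡ v

load-enumeration : ∀ {𝒢 H} (C : Cover 𝒢 H) v → Enumeration (Fibre C v) (load C v)
load-enumeration C v =
  subst (Enumeration (Fibre C v)) (cong sum (≡-sym (map-tabulate id fibreSize)))
    (Σ-enumeration λ i → filter-enumeration (λ a → φ C i a ≟ v) id)
  where
  fibreSize : Fin (t C) → ℕ
  fibreSize i = length (filter (λ a → φ C i a ≟ v) (allFin _))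

load-≤ : ∀ {𝒢 𝒢' H H'} (C : Cover 𝒢 H) (C' : Cover 𝒢' H') {w v} (κ : Key C' → Key C) →
  (∀ {y} → Fibre C' w y → Fibre C v (κ y)) →
  (∀ {y z} → Fibre C' w y → Fibre C' w z → κ y ≡ κ z → y ≡ z) →
  load C' w ≤ load C v
load-≤ C C' = enumeration-≤ (load-enumeration C' _) (load-enumeration C _)

EdgeOver : (M : Graph) {X : Set} → (V M → X) → X → X → Set
EdgeOver M ψ x y = Σ[ a ∈ V M ] Σ[ b ∈ V M ] (E M a b × ψ a ≡ x × ψ b ≡ y)

⊕-adj-↑ˡ : ∀ A B a b → adj (A ⊕ B) (a ↑ˡ n B) (b ↑ˡ n B) ≡ adj A a b
⊕-adj-↑ˡ A B a b rewrite splitAt-↑ˡ (n A) a (n B) | splitAt-↑ˡ (n A) b (n B) = refl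

⊕-adj-↑ʳ : ∀ A B a b → adj (A ⊕ B) (n A ↑ʳ a) (n A ↑ʳ b) ≡ adj B a b
⊕-adj-↑ʳ A B a b rewrite splitAt-↑ʳ (n A) (n B) a | splitAt-↑ʳ (n A) (n B) b = refl

⊕-edge : ∀ A B {x y} → E (A ⊕ B) x y → EdgeOver A (_↑ˡ n B) x y ⊎ EdgeOver B (n A ↑ʳ_) x y
⊕-edge A B {x} {y} e with splitAt (n A) x in ex | splitAt (n A) y in ey
... | inj₁ a | inj₁ b = inj₁ (a , b , e , splitAt⁻¹-↑ˡ ex , splitAt⁻¹-↑ˡ ey)
... | inj₂ a | inj₂ b = inj₂ (a , b , e , splitAt⁻¹-↑ʳ ex , splitAt⁻¹-↑ʳ ey)
... | inj₁ _ | inj₂ _ with () ← e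
... | inj₂ _ | inj₁ _ with () ← e

⨁ᶠ : ∀ {N} → (Fin N → Graph) → Graph
⨁ᶠ F = ⨁ (tabulate F)

ι : ∀ {N} (F : Fin N → Graph) p → V (F p) → V (⨁ᶠ F)
ι {suc N} F zero    x = x ↑ˡ n (⨁ᶠ (F ∘ suc))
ι {suc N} F (suc p) x = n (F zero) ↑ʳ ι (F ∘ suc) p x

ι-edge : ∀ {N} (F : Fin N → Graph) p {x y} → E (F p) x y → E (⨁ᶠ F) (ι F p x) (ι F p y)
ι-edge {suc N} F zero    e = trans (⊕-adj-↑ˡ (F zero) (⨁ᶠ (F ∘ suc)) _ _) e
ι-edge {suc N} F (suc p) e =
  trans (⊕-adj-↑ʳ (F zero) (⨁ᶠ (F ∘ suc)) _ _) (ι-edge (F ∘ suc) p e)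

ι-injective : ∀ {N} (F : Fin N → Graph) {p q x y} → ι F p x ≡ ι F q y →
  _≡_ {A = Σ (Fin N) (V ∘ F)} (p , x) (q , y)
ι-injective {suc N} F {zero}  {zero}  eq = cong (zero ,_) (↑ˡ-injective _ _ _ eq)
ι-injective {suc N} F {suc p} {suc q} eq
  with refl ← ι-injective (F ∘ suc) (↑ʳ-injective (n (F zero)) _ _ eq) = refl
ι-injective {suc N} F {zero}  {suc q} {x} eq
  with () ← trans (≡-sym (splitAt-↑ˡ (n (F zero)) x _))
                  (trans (cong (splitAt _) eq) (splitAt-↑ʳ _ _ _))
ι-injective {suc N} F {suc p} {zero}  {y = y} eq
  with () ← trans (≡-sym (splitAt-↑ʳ (n (F zero)) _ _))
                  (trans (cong (splitAt _) eq) (splitAt-↑ˡ _ y _))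

ι-surjective : ∀ {N} (F : Fin N → Graph) y → Σ[ p ∈ Fin N ] Σ[ x ∈ V (F p) ] ι F p x ≡ y
ι-surjective {suc N} F y with splitAt (n (F zero)) y in ey
... | inj₁ x = zero , x , splitAt⁻¹-↑ˡ ey
... | inj₂ z with ι-surjective (F ∘ suc) z
...   | p , x , refl = suc p , x , splitAt⁻¹-↑ʳ ey

⨁ᶠ-edge : ∀ {N} (F : Fin N → Graph) {y z} → E (⨁ᶠ F) y z →
  Σ[ p ∈ Fin N ] EdgeOver (F p) (ι F p) y z
⨁ᶠ-edge {suc N} F e with ⊕-edge (F zero) (⨁ᶠ (F ∘ suc)) e
... | inj₁ over = zero , over
... | inj₂ (a , b , e' , refl , refl) with ⨁ᶠ-edge (F ∘ suc) e'
...   | p , x , x' , e'' , refl , refl = suc p , x , x' , e'' , refl , refl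

module _ {N} (F : Fin N → Graph) {X : Set} (ψ : ∀ p → V (F p) → X) where

  copair : V (⨁ᶠ F) → X
  copair y = ψ (proj₁ (ι-surjective F y)) (proj₁ (proj₂ (ι-surjective F y)))

  copair-ι : ∀ p x → copair (ι F p x) ≡ ψ p x
  copair-ι p x = cong (uncurry ψ) (ι-injective F (proj₂ (proj₂ (ι-surjective F (ι F p x)))))

  copair-injective : (∀ p → Injective _≡_ _≡_ (ψ p)) →
    (∀ {p q x y} → ψ p x ≡ ψ q y → p ≡ q) → Injective _≡_ _≡_ copair
  copair-injective ψ-inj ψ-disjoint {y} {z} eq with ι-surjective F y | ι-surjective F z
  ... | p , x , refl | q , x' , refl with ψ-disjoint eq
  ... | refl = cong (ι F p) (ψ-inj p eq)

module _ {N} (F : Fin N → Graph) {Y : Graph} (ψ : ∀ p → V (F p) → V Y) where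

  copair-hom : (∀ p {a b} → E (F p) a b → E Y (ψ p a) (ψ p b)) →
    ∀ {y z} → E (⨁ᶠ F) y z → E Y (copair F ψ y) (copair F ψ z)
  copair-hom ψ-hom e with ⨁ᶠ-edge F e
  ... | p , x , x' , e' , refl , refl rewrite copair-ι F ψ p x | copair-ι F ψ p x' = ψ-hom p e'

  copair-edge : ∀ {x y} → Σ[ p ∈ Fin N ] EdgeOver (F p) (ψ p) x y →
    EdgeOver (⨁ᶠ F) (copair F ψ) x y
  copair-edge (p , a , b , e , refl , refl) =
    ι F p a , ι F p b , ι-edge F p e , copair-ι F ψ p a , copair-ι F ψ p b

⨁ᶠ-overline : ∀ {𝒢 N} (F : Fin N → Graph) → (∀ p → 𝒢 (F p)) → Overline 𝒢 (⨁ᶠ F)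
⨁ᶠ-overline F F∈𝒢 = tabulate F , tabulate⁺ F∈𝒢 , Iso-refl
  where
  Iso-refl : ∀ {G} → Iso G G
  Iso-refl = record
    { to = id ; from = id ; from∘to = λ _ → refl ; to∘from = λ _ → refl ; pres = λ _ _ → refl }

record Splitting (𝒢 : GraphClass) (G : Graph) : Set where
  field
    size   : ℕ
    part   : Fin size → Graph
    part∈𝒢 : ∀ k → 𝒢 (part k)
    iso    : Iso G (⨁ᶠ part)

overline-splitting : ∀ {𝒢 G} → Overline 𝒢 G → Splitting 𝒢 G
overline-splitting {G = G} (Gs , Gs∈𝒢 , G≅⨁Gs) = record
  { size   = length Gs
  ; part   = lookup Gs
  ; part∈𝒢 = λ k → All.lookup Gs∈𝒢 (∈-lookup k)
  ; iso    = subst (Iso G) (cong ⨁ (≡-sym (tabulate-lookup Gs))) G≅⨁Gs }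

module PartMaps {𝒢 G H} (S : Splitting 𝒢 G) (ϕ : V G → V H) where
  open Splitting S public
  open Iso iso

  χ : ∀ k → V (part k) → V H
  χ k = ϕ ∘ from ∘ ι part k

  from-edge : ∀ {y z} → E (⨁ᶠ part) y z → E G (from y) (from z)
  from-edge {y} {z} e = begin
    adj G (from y) (from z)                   ≡⟨ pres (from y) (from z) ⟨
    adj (⨁ᶠ part) (to (from y)) (to (from z)) ≡⟨ cong₂ (adj (⨁ᶠ part)) (to∘from y) (to∘from z) ⟩
    adj (⨁ᶠ part) y z                         ≡⟨ e ⟩
    true                                      ∎
    where open ≡-Reasoning

  from-injective : Injective _≡_ _≡_ from
  from-injective {y} {z} eq = trans (≡-sym (to∘from y)) (trans (cong to eq) (to∘from z))

  χ-hom : (∀ {a b} → E G a b → E H (ϕ a) (ϕ b)) →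
    ∀ k {c c'} → E (part k) c c' → E H (χ k c) (χ k c')
  χ-hom ϕ-hom k e = ϕ-hom (from-edge (ι-edge part k e))

  χ-injective : Injective _≡_ _≡_ ϕ → ∀ {k k' c c'} → χ k c ≡ χ k' c' →
    _≡_ {A = Σ (Fin size) (V ∘ part)} (k , c) (k' , c')
  χ-injective ϕ-inj eq = ι-injective part (from-injective (ϕ-inj eq))

  χ-edge : ∀ {x y} → EdgeOver G ϕ x y → Σ[ k ∈ Fin size ] EdgeOver (part k) (χ k) x y
  χ-edge (a , b , e , refl , refl) with ⨁ᶠ-edge part (trans (pres a b) e)
  ... | k , c , c' , e' , ιc , ιc' =
    k , c , c' , e' , cong ϕ (trans (cong from ιc) (from∘to a)) ,
                      cong ϕ (trans (cong from ιc') (from∘to b))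

module _ (G : Graph) where

  edge-sym : ∀ {x y} → E G x y → E G y x
  edge-sym {x} {y} e = trans (sym G y x) e

  reach-trans : ∀ {x y z} → Reach G x y → Reach G y z → Reach G x z
  reach-trans here       r = r
  reach-trans (step e q) r = step e (reach-trans q r)

module ComponentLabelling (G : Graph) where

  Labelling : Set
  Labelling = V G → V G

  Sound : Labelling → Set
  Sound lb = ∀ x y → lb x ≡ lb y → Reach G x y

  merge : Labelling → V G → V G → Labelling
  merge lb s d x with lb x ≟ lb d
  ... | yes _ = lb s
  ... | no  _ = lb x

  merge-preserves : ∀ lb s d {x y} → lb x ≡ lb y → merge lb s d x ≡ merge lb s d y
  merge-preserves lb s d {x} {y} eq with lb x ≟ lb d | lb y ≟ lb d
  ... | yes _  | yes _  = refl
  ... | no  _  | no  _  = eq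
  ... | yes xd | no ¬yd = ⊥-elim (¬yd (trans (≡-sym eq) xd))
  ... | no ¬xd | yes yd = ⊥-elim (¬xd (trans eq yd))

  merge-joins : ∀ lb s d → merge lb s d s ≡ merge lb s d d
  merge-joins lb s d with lb s ≟ lb d | lb d ≟ lb d
  ... | _     | no ¬dd = ⊥-elim (¬dd refl)
  ... | yes _ | yes _  = refl
  ... | no  _ | yes _  = refl

  merge-sound : ∀ {lb s d} → Sound lb → E G s d → Sound (merge lb s d)
  merge-sound {lb} {s} {d} sound e x y eq with lb x ≟ lb d | lb y ≟ lb d
  ... | yes xd | yes yd = sound x y (trans xd (≡-sym yd))
  ... | yes xd | no  _  = reach-trans G (sound x d xd) (step (edge-sym G e) (sound s y eq))
  ... | no  _  | yes yd = reach-trans G (sound x s eq) (step e (sound d y (≡-sym yd)))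
  ... | no  _  | no  _  = sound x y eq

  mergeAll : List (V G × V G) → Labelling → Labelling
  mergeAll []             lb = lb
  mergeAll ((s , d) ∷ ps) lb = mergeAll ps (merge lb s d)

  mergeAll-preserves : ∀ ps lb {x y} → lb x ≡ lb y → mergeAll ps lb x ≡ mergeAll ps lb y
  mergeAll-preserves []             lb eq = eq
  mergeAll-preserves ((s , d) ∷ ps) lb eq =
    mergeAll-preserves ps (merge lb s d) (merge-preserves lb s d eq)

  mergeAll-joins : ∀ ps lb {s d} → (s , d) ∈ ps → mergeAll ps lb s ≡ mergeAll ps lb d
  mergeAll-joins ((s , d) ∷ ps) lb (here refl)   =
    mergeAll-preserves ps (merge lb s d) (merge-joins lb s d)
  mergeAll-joins ((s , d) ∷ ps) lb (there sd∈ps) = mergeAll-joins ps (merge lb s d) sd∈ps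

  mergeAll-sound : ∀ {ps lb} → All (uncurry (E G)) ps → Sound lb → Sound (mergeAll ps lb)
  mergeAll-sound []       sound = sound
  mergeAll-sound (e ∷ es) sound = mergeAll-sound es (merge-sound sound e)

  edge? : Decidable (uncurry (E G))
  edge? (x , y) = adj G x y ≟ᵇ true

  vertexPairs : List (V G × V G)
  vertexPairs = cartesianProduct (allFin (n G)) (allFin (n G))

  componentLabel : V G → V G
  componentLabel = mergeAll (filter edge? vertexPairs) id

  componentLabel-edge : ∀ {x y} → E G x y → componentLabel x ≡ componentLabel y
  componentLabel-edge {x} {y} e =
    mergeAll-joins _ id (∈-filter⁺ edge? (∈-cartesianProduct⁺ (∈-allFin x) (∈-allFin y)) e)

  componentLabel-reach : ∀ x y → componentLabel x ≡ componentLabel y → Reach G x y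
  componentLabel-reach = mergeAll-sound (all-filter edge? vertexPairs) λ { x .x refl → here }

∧-≡-true : ∀ {x y} → x ∧ y ≡ true → x ≡ true × y ≡ true
∧-≡-true {true} e = refl , e

module Restriction {H H' : Graph} (emb : V H' → V H) (emb-inj : Injective _≡_ _≡_ emb)
  (emb-hom : ∀ {x y} → E H' x y → E H (emb x) (emb y))
  {L : ℕ} (lab : V H' → Fin L) (lab-edge : ∀ {x y} → E H' x y → lab x ≡ lab y) where

  ClassesInduced : Set
  ClassesInduced = ∀ x y → lab x ≡ lab y → E H (emb x) (emb y) → E H' x y

  RestrictionClosed : GraphClass → Set
  RestrictionClosed 𝒢 = Monotone 𝒢 ⊎ (Hereditary 𝒢 × ClassesInduced)

  module Piece (M : Graph) (χ : V M → V H) (w : Fin L) where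

    Above : V M → Set
    Above a = Σ[ x ∈ V H' ] (χ a ≡ emb x × lab x ≡ w)

    above? : Decidable Above
    above? a = any? λ x → (χ a ≟ emb x) ×-dec (lab x ≟ w)

    size : ℕ
    size = length (filter above? (allFin (n M)))

    enum : Enumeration Above size
    enum = filter-enumeration above? id

    base : Fin size → V M
    base = pos enum

    lift : Fin size → V H'
    lift j = proj₁ (pos-sat enum j)

    χ-base : ∀ j → χ (base j) ≡ emb (lift j)
    χ-base j = proj₁ (proj₂ (pos-sat enum j))

    lab-lift : ∀ j → lab (lift j) ≡ w
    lab-lift j = proj₂ (proj₂ (pos-sat enum j))

    restrict : Graph
    restrict = record
      { n      = size
      ; adj    = λ j k → adj M (base j) (base k) ∧ adj H' (lift j) (lift k)
      ; sym    = λ j k → cong₂ _∧_ (sym M (base j) (base k)) (sym H' (lift j) (lift k))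
      ; irrefl = λ j → cong (_∧ adj H' (lift j) (lift j)) (irrefl M (base j)) }

    lift-hom : ∀ {j k} → E restrict j k → E H' (lift j) (lift k)
    lift-hom e = proj₂ (∧-≡-true e)

    lift-injective : Injective _≡_ _≡_ χ → Injective _≡_ _≡_ lift
    lift-injective χ-inj {j} {k} eq =
      pos-injective enum (χ-inj (trans (χ-base j) (trans (cong emb eq) (≡-sym (χ-base k)))))

    restrict-subgraph : Subgraph restrict M
    restrict-subgraph = base , pos-injective enum , λ _ _ e → proj₁ (∧-≡-true e)

    restrict-induced : (∀ j k → E M (base j) (base k) → E H' (lift j) (lift k)) →
      InducedSubgraph restrict M
    restrict-induced lifts = base , pos-injective enum , same-adj
      where
      same-adj : ∀ j k → adj M (base j) (base k) ≡ adj restrict j k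
      same-adj j k with adj M (base j) (base k) in e
      ... | false = refl
      ... | true  = ≡-sym (lifts j k e)

    restrict∈𝒢 : ∀ {𝒢} → RestrictionClosed 𝒢 → (∀ {a b} → E M a b → E H (χ a) (χ b)) →
      𝒢 M → 𝒢 restrict
    restrict∈𝒢 (inj₁ mono)            _     = mono M restrict restrict-subgraph
    restrict∈𝒢 (inj₂ (her , induced)) χ-hom = her M restrict (restrict-induced lifts)
      where
      lifts : ∀ j k → E M (base j) (base k) → E H' (lift j) (lift k)
      lifts j k e = induced (lift j) (lift k) (trans (lab-lift j) (≡-sym (lab-lift k)))
        (subst₂ (E H) (χ-base j) (χ-base k) (χ-hom e))

    index-above : ∀ {a x} → χ a ≡ emb x → lab x ≡ w →
      Σ[ j ∈ Fin size ] (base j ≡ a × lift j ≡ x)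
    index-above {a} {x} χa lx =
      j , base-j , emb-inj (trans (≡-sym (χ-base j)) (trans (cong χ base-j) χa))
      where
      j = index enum a (x , χa , lx)
      base-j = pos-index enum a (x , χa , lx)

    restrict-edge : ∀ {x y} → EdgeOver M χ (emb x) (emb y) → lab x ≡ w → E H' x y →
      EdgeOver restrict lift x y
    restrict-edge (a , b , e , χa , χb) lx e'
      with index-above χa lx | index-above χb (trans (≡-sym (lab-edge e')) lx)
    ... | j , refl , refl | k , refl , refl = j , k , cong₂ _∧_ e e' , refl , refl

  module Family {T} (M : Fin T → Graph) (χ : ∀ i → V (M i) → V H) where

    module P (q : Fin T × Fin L) = Piece (M (proj₁ q)) (χ (proj₁ q)) (proj₂ q)

    origin : Fin (T * L) → Fin T × Fin L
    origin = remQuot L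

    piece : Fin (T * L) → Graph
    piece p = P.restrict (origin p)

    lift : ∀ p → V (piece p) → V H'
    lift p = P.lift (origin p)

    lift-separates : ∀ {p q j k} → lift p j ≡ lift q k →
      proj₁ (origin p) ≡ proj₁ (origin q) → p ≡ q
    lift-separates {p} {q} {j} {k} eq same-i = begin
      p                          ≡⟨ combine-remQuot {T} L p ⟨
      uncurry combine (origin p) ≡⟨ cong₂ combine same-i same-w ⟩
      uncurry combine (origin q) ≡⟨ combine-remQuot {T} L q ⟩
      q                          ∎
      where
      open ≡-Reasoning
      same-w : proj₂ (origin p) ≡ proj₂ (origin q)
      same-w = trans (≡-sym (P.lab-lift _ j)) (trans (cong lab eq) (P.lab-lift _ k))

    piece-edge : ∀ {x y} → Σ[ i ∈ Fin T ] EdgeOver (M i) (χ i) (emb x) (emb y) → E H' x y →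
      Σ[ p ∈ Fin (T * L) ] EdgeOver (piece p) (lift p) x y
    piece-edge {x} {y} (i , over) e' = combine i (lab x) , at (remQuot-combine i (lab x))
      where
      at : ∀ {q} → q ≡ (i , lab x) → EdgeOver (P.restrict q) (P.lift q) x y
      at refl = P.restrict-edge (i , lab x) over refl e'

  module _ {𝒢} (closed : RestrictionClosed 𝒢) where

    module _ (C : Cover 𝒢 H) where
      open Family (comp C) (φ C)

      restrictCover : Cover 𝒢 H'
      restrictCover = record
        { t    = t C * L
        ; comp = piece
        ; inC  = λ p → P.restrict∈𝒢 (origin p) closed (hom C _ _ _) (inC C _)
        ; φ    = lift
        ; hom  = λ p _ _ → P.lift-hom (origin p)
        ; surj = λ x y e' → piece-edge (surj C (emb x) (emb y) (emb-hom e')) e' }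

      restrictCover-injective : IsInjective C → IsInjective restrictCover
      restrictCover-injective C-inj p = P.lift-injective (origin p) (C-inj _)

      restrictCover-load : ∀ x → load restrictCover x ≤ load C (emb x)
      restrictCover-load x = load-≤ C restrictCover key key-fibre key-injective
        where
        key : Key restrictCover → Key C
        key (p , j) = proj₁ (origin p) , P.base (origin p) j
        key-fibre : ∀ {y} → Fibre restrictCover x y → Fibre C (emb x) (key y)
        key-fibre {p , j} refl = P.χ-base (origin p) j
        key-injective : ∀ {y z} → Fibre restrictCover x y → Fibre restrictCover x z →
          key y ≡ key z → y ≡ z
        key-injective {p , j} {q , k} refl lk same-key
          with refl ← lift-separates (≡-sym lk) (cong proj₁ same-key) =
          cong (p ,_) (pos-injective (P.enum (origin p)) (,-injectiveʳ same-key))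

    module _ (C : Cover (Overline 𝒢) H) (C-inj : IsInjective C) where
      module S (i : Fin (t C)) = PartMaps {H = H} (overline-splitting (inC C i)) (φ C i)
      module F (i : Fin (t C)) = Family (S.part i) (S.χ i)

      restrictUnionCover : Cover (Overline 𝒢) H'
      restrictUnionCover = record
        { t    = t C
        ; comp = λ i → ⨁ᶠ (F.piece i)
        ; inC  = λ i → ⨁ᶠ-overline (F.piece i) λ p →
                   F.P.restrict∈𝒢 i (F.origin i p) closed (S.χ-hom i (hom C i _ _) _) (S.part∈𝒢 i _)
        ; φ    = λ i → copair (F.piece i) (F.lift i)
        ; hom  = λ i _ _ → copair-hom (F.piece i) {H'} (F.lift i) λ p → F.P.lift-hom i (F.origin i p)
        ; surj = λ x y e' → let i , over = surj C (emb x) (emb y) (emb-hom e') in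
                   i , copair-edge (F.piece i) {H'} (F.lift i) (F.piece-edge i (S.χ-edge i over) e') }

      restrictUnionCover-injective : IsInjective restrictUnionCover
      restrictUnionCover-injective i = copair-injective (F.piece i) (F.lift i) lift-inj lift-disjoint
        where
        lift-inj : ∀ p → Injective _≡_ _≡_ (F.lift i p)
        lift-inj p = F.P.lift-injective i (F.origin i p) (,-injectiveʳ ∘ S.χ-injective i (C-inj i))
        lift-disjoint : ∀ {p q j k} → F.lift i p j ≡ F.lift i q k → p ≡ q
        lift-disjoint {p} {q} {j} {k} eq = F.lift-separates i eq (cong proj₁ (S.χ-injective i (C-inj i)
          (trans (F.P.χ-base i _ j) (trans (cong emb eq) (≡-sym (F.P.χ-base i _ k))))))

    hasCover-transfer : ∀ x {k} → L ≡ 1 ⊎ x ≢ g → HasCover x 𝒢 H k → HasCover x 𝒢 H' k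
    hasCover-transfer g (inj₁ refl) (C , t≡k , C-inj) =
      restrictCover C , trans (*-identityʳ (t C)) t≡k , restrictCover-injective C C-inj
    hasCover-transfer g (inj₂ x≢g) _ = ⊥-elim (x≢g refl)
    hasCover-transfer u _ (C , t≡k , C-inj) =
      restrictUnionCover C C-inj , t≡k , restrictUnionCover-injective C C-inj
    hasCover-transfer l _ (C , local , C-inj) =
      restrictCover C , (λ x → ≤-trans (restrictCover-load C x) (local (emb x))) ,
      restrictCover-injective C C-inj
    hasCover-transfer f _ (C , local) =
      restrictCover C , λ x → ≤-trans (restrictCover-load C x) (local (emb x))

coverNumber-mono : ∀ {x 𝒢 H H' c' c} → (∀ {k} → HasCover x 𝒢 H k → HasCover x 𝒢 H' k) →
  IsCoverNumber x 𝒢 H' c' → IsCoverNumber x 𝒢 H c → c' ≤ c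
coverNumber-mono transfer (_ , least) (cover , _) = least _ (transfer cover)

oneClass : (G : Graph) → V G → Fin 1
oneClass _ _ = zero

lemma9 : (𝒢 : GraphClass) → 𝒢 K₂ → (x : Kind) → (H : Graph) →
    (Monotone 𝒢 → ∀ H' → Subgraph H' H →
       ∀ c' c → IsCoverNumber x 𝒢 H' c' → IsCoverNumber x 𝒢 H c → c' ≤ c)
    × (Hereditary 𝒢 → ∀ H' → InducedSubgraph H' H →
       ∀ c' c → IsCoverNumber x 𝒢 H' c' → IsCoverNumber x 𝒢 H c → c' ≤ c)
    × (Hereditary 𝒢 → x ≢ g → ∀ H' → WeakInducedSubgraph H' H →
       ∀ c' c → IsCoverNumber x 𝒢 H' c' → IsCoverNumber x 𝒢 H c → c' ≤ c)
lemma9 𝒢 _ x H =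
    (λ mono H' (emb , emb-inj , emb-hom) _ _ → coverNumber-mono
       (hasCover-transfer emb emb-inj (emb-hom _ _) (oneClass H') (λ _ → refl)
          (inj₁ mono) x (inj₁ refl)))
  , (λ her H' (emb , emb-inj , same-adj) _ _ → coverNumber-mono
       (hasCover-transfer emb emb-inj (trans (same-adj _ _)) (oneClass H') (λ _ → refl)
          (inj₂ (her , λ a b _ e → trans (≡-sym (same-adj a b)) e)) x (inj₁ refl)))
  , (λ her x≢g H' (emb , emb-inj , emb-hom , weak) _ _ → coverNumber-mono
       (hasCover-transfer emb emb-inj (emb-hom _ _) (componentLabel H') (componentLabel-edge H')
          (inj₂ (her , λ a b same → weak a b (componentLabel-reach H' a b same))) x (inj₂ x≢g)))
  where
  open Restriction using (hasCover-transfer)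
  open ComponentLabelling using (componentLabel; componentLabel-edge; componentLabel-reach)
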